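{- Let $d$ be the number of deletions made by the optimal algorithm and let $w$ be the total number of wrong moves made by Random-deletion by the time it terminates. Then the edit distance between the final string produced by Random-deletion and $\sigma$ is at most $d+2w$.
   Context: $T$ is a finite set of open parentheses, each $x\in T$ with unique congruent close parenthesis $\bar{x}$; well-balanced means belonging to the Dyck language $S\to SS\mid\varepsilon\mid aS\bar{a}$. Input $\sigma=\sigma[1]\cdots\sigma[n]$ over $T\cup\bar{T}$. Random-deletion: scan left to right with a stack; push open parentheses; on a close parenthesis, delete it if the stack is empty, match (pop) it with the stack top if they match, and otherwise delete either the stack top or the current symbol with probability $1/2$ each independently; after the scan, delete the remaining stack symbols one at a time. Time starts at $t=0$ and increases by one at every match or deletion; the final string is $\sigma$ with all symbols deleted by Random-deletion removed. Fix an optimal deletion-only solution ("the optimal algorithm"): a stack-based single-scan procedure that pushes opens, pops on a match and on a mismatch deletes the stack top or the current close parenthesis, using exactly the minimum number $d$ of deletions needed to make $\sigma$ well-balanced; it determines which indices are deleted and which pairs are matched. $A_t$ is the set of indices matched or deleted by Random-deletion up to and including time $t$; $A_t^{OPT}=\{i : i\in A_t \text{ or } i \text{ is matched by the optimal algorithm with some index in } A_t\}$. A deletion at time $t$ is a correct move if $|A_t^{OPT}\setminus A_t|\le|A_{t-1}^{OPT}\setminus A_{t-1}|$ and a wrong move otherwise. -}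

module Defs where

open import Data.Nat using (ℕ; zero; suc; _+_; _∸_; _≤_; _<ᵇ_; _≡ᵇ_)
open import Data.Nat.Properties using () renaming (_≟_ to _≟ℕ_)
open import Data.Bool using (Bool; true; false; if_then_else_; not; _∧_; _∨_)
open import Data.Fin using (Fin)
open import Data.Fin.Properties using () renaming (_≟_ to _≟F_)
open import Data.List using (List; []; _∷_; _++_; [_]; length; map; take; concatMap; upTo; filterᵇ; drop)
open import Data.Bool.ListAction using (any)
open import Data.List.Relation.Binary.Sublist.Propositional using (_⊆_)
open import Data.Product using (_×_; _,_; proj₁; proj₂)
open import Relation.Nullary using (yes; no; does)
open import Data.Nat using (_⊔_; _⊓_)

data Sym (k : ℕ) : Set where
  op : Fin k → Sym k
  cl : Fin k → Sym k

_==S_ : ∀ {k} → Sym k → Sym k → Bool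
op a ==S op b = does (a ≟F b)
cl a ==S cl b = does (a ≟F b)
op _ ==S cl _ = false
cl _ ==S op _ = false

data Balanced {k : ℕ} : List (Sym k) → Set where
  empty : Balanced []
  cat   : ∀ {u v} → Balanced u → Balanced v → Balanced (u ++ v)
  wrap  : ∀ {u} (a : Fin k) → Balanced u → Balanced (op a ∷ u ++ [ cl a ])

-- Events (time steps) of the stack procedure; indices are 0-based positions in σ.
data Event : Set where
  match : ℕ → ℕ → Event   -- match (open index) (close index)
  del   : ℕ → Event

-- Stack of (index, kind) for open parentheses; head = top.
Stack : ℕ → Set
Stack k = List (ℕ × Fin k)

-- Processing close parenthesis of kind a at index i, given the choice function
-- c and the current time t (number of events so far, used to index the choice).
-- c t = true : delete the stack top (and keep processing the current symbol);
-- c t = false: delete the current symbol.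
closeStep : ∀ {k} → (ℕ → Bool) → ℕ → ℕ → Fin k → Stack k → List Event × Stack k
closeStep c t i a [] = [ del i ] , []
closeStep c t i a ((j , b) ∷ s) with a ≟F b
... | yes _ = [ match j i ] , s
... | no _ with c t
...   | true  = let r = closeStep c (suc t) i a s in (del j ∷ proj₁ r) , proj₂ r
...   | false = [ del i ] , ((j , b) ∷ s)

-- Full left-to-right scan: time t, position i, remaining input, stack.
-- After the scan, the remaining stack symbols are deleted one at a time.
run : ∀ {k} → (ℕ → Bool) → ℕ → ℕ → List (Sym k) → Stack k → List Event
run c t i [] s = map (λ p → del (proj₁ p)) s
run c t i (op a ∷ σ) s = run c t (suc i) σ ((i , a) ∷ s)
run c t i (cl a ∷ σ) s =
  let r = closeStep c t i a s in proj₁ r ++ run c (t + length (proj₁ r)) (suc i) σ (proj₂ r)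

-- The sequence of events of the stack procedure on σ under choices c;
-- event number t (1-based) happens at time t.
trace : ∀ {k} → (ℕ → Bool) → List (Sym k) → List Event
trace c σ = run c 0 0 σ []

isDel : Event → Bool
isDel (match _ _) = false
isDel (del _) = true

numDel : List Event → ℕ
numDel es = length (filterᵇ isDel es)

deletedIdx : List Event → List ℕ
deletedIdx [] = []
deletedIdx (match _ _ ∷ es) = deletedIdx es
deletedIdx (del i ∷ es) = i ∷ deletedIdx es

memℕ : ℕ → List ℕ → Bool
memℕ i xs = any (λ j → i ≡ᵇ j) xs

removeFrom : ∀ {A : Set} → ℕ → List ℕ → List A → List A
removeFrom i D [] = []
removeFrom i D (x ∷ xs) = if memℕ i D then removeFrom (suc i) D xs else x ∷ removeFrom (suc i) D xs

finalString : ∀ {k} → (ℕ → Bool) → List (Sym k) → List (Sym k)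
finalString c σ = removeFrom 0 (deletedIdx (trace c σ)) σ

-- The choice function c describes an optimal deletion-only solution:
-- its number of deletions is at most that of any well-balanced subsequence
-- (hence exactly the minimum, as the output of the stack procedure is well-balanced).
OptimalChoice : ∀ {k} → (ℕ → Bool) → List (Sym k) → Set
OptimalChoice {k} c σ =
  (τ : List (Sym k)) → τ ⊆ σ → Balanced τ → numDel (trace c σ) + length τ ≤ length σ

touched : Event → List ℕ
touched (match j i) = j ∷ i ∷ []
touched (del i) = [ i ]

A : List Event → ℕ → List ℕ
A es t = concatMap touched (take t es)

matchedIn : List Event → ℕ → ℕ → Bool
matchedIn es i j = any f es
  where
  f : Event → Bool
  f (match a b) = ((a ≡ᵇ i) ∧ (b ≡ᵇ j)) ∨ ((a ≡ᵇ j) ∧ (b ≡ᵇ i))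
  f (del _) = false

count : (ℕ → Bool) → List ℕ → ℕ
count p xs = length (filterᵇ p xs)

-- |A_t^OPT \ A_t| for the random run `es`, optimal run `opt`, input length n
gap : ℕ → List Event → List Event → ℕ → ℕ
gap n opt es t =
  count (λ i → not (memℕ i (A es t)) ∧ any (λ j → matchedIn opt i j) (A es t)) (upTo n)

-- Is the event at time t (1-based, t ≥ 1) a deletion?
delAt : List Event → ℕ → Bool
delAt es zero = false
delAt es (suc t) = any isDel (take 1 (drop t es))

wrongMoves : ℕ → List Event → List Event → ℕ
wrongMoves n opt es =
  count (λ t → delAt es (suc t) ∧ (gap n opt es t <ᵇ gap n opt es (suc t))) (upTo (length es))

editDist : ∀ {k} → List (Sym k) → List (Sym k) → ℕ
editDist [] ys = length ys
editDist (x ∷ xs) [] = suc (length xs)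
editDist (x ∷ xs) (y ∷ ys) =
  (suc (editDist xs (y ∷ ys)) ⊓ suc (editDist (x ∷ xs) ys))
  ⊓ (editDist xs ys + (if x ==S y then 0 else 1))

-- Removing the deleted symbols costs at most one edit each, so it suffices to bound the
-- number of deletions of Random-deletion. Compare its run with the optimal one through the
-- potential Φ(L) = number of indices not deleted by the optimal algorithm that lie in L or are
-- matched by it to an index of L. Along L = A_t, a correct deletion leaves Φ unchanged, while a
-- wrong deletion and a match each raise it by at most 2: the optimal partners of a randomly
-- matched pair cannot both be still unprocessed, as optimal matches never cross and every index
-- strictly inside the random pair has already been processed. So Φ(A_T) ≤ 2 (#matches + w).
-- Every touched index is deleted by the optimal algorithm or counted by Φ, hence
-- #deletions + 2 #matches = |A_T| ≤ Φ(A_T) + d, i.e. #deletions ≤ d + 2 w.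

module Submission where

open import Defs

open import Data.Bool using (Bool; true; false; not; _∧_; _∨_; T; if_then_else_)
open import Data.Bool.ListAction using (any)
open import Data.Bool.Properties using (T-∧; T-∨; T-≡)
open import Data.Empty using (⊥; ⊥-elim)
open import Data.Fin.Properties using () renaming (_≟_ to _≟F_)
open import Data.List using (List; []; _∷_; _++_; [_]; length; map; take; drop; concatMap; upTo; applyUpTo; filterᵇ)
open import Data.List.Membership.Propositional using (_∈_; _∉_; find; lose)
open import Data.List.Membership.Propositional.Properties using (∈-upTo⁺; ∈-++⁻; ∈-++⁺ˡ; ∈-++⁺ʳ)
open import Data.List.Properties using (++-assoc; ++-identityʳ; length-++; concatMap-++; take-all; filter-++; upTo-∷ʳ)
open import Data.List.Relation.Unary.All as All using (All)
open import Data.List.Relation.Unary.AllPairs as AllPairs using (AllPairs; []; _∷_)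
open import Data.List.Relation.Unary.Any as Any using (here; there)
open import Data.List.Relation.Unary.Any.Properties using (any⁺; any⁻; concatMap⁺; concatMap⁻)
open import Data.List.Relation.Unary.Unique.Propositional using (Unique)
open import Data.List.Relation.Unary.Unique.Propositional.Properties using (upTo⁺)
open import Data.Nat using (ℕ; zero; suc; _+_; _*_; _≤_; _<_; _>_; _≡ᵇ_; _<ᵇ_; z≤n; s≤s; s≤s⁻¹)
open import Data.Nat.Properties
open import Data.List.Membership.DecPropositional _≟_ using (_∈?_)
open import Data.Nat.Tactic.RingSolver using (solve-∀)
open import Data.Product using (∃; ∃₂; ∃-syntax; _×_; _,_; proj₁; proj₂)
open import Data.Sum using (_⊎_; inj₁; inj₂; [_,_]′)
open import Data.Unit using (tt)
open import Function using (_∘_; id; Equivalence)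
open import Relation.Binary.Definitions using (tri<; tri≈; tri>)
open import Relation.Binary.PropositionalEquality
  using (_≡_; _≢_; refl; sym; trans; cong; cong₂; subst; module ≡-Reasoning)
open import Relation.Nullary using (¬_; yes; no; T?)
open import Relation.Nullary.Decidable using (dec-true)

open Equivalence using (to; from)
open import Algebra.Properties.CommutativeSemigroup +-commutativeSemigroup using (interchange)

T-not⁺ : ∀ {b} → ¬ T b → T (not b)
T-not⁺ {false} _ = tt
T-not⁺ {true} ¬b = ¬b tt

T-not⁻ : ∀ {b} → T (not b) → ¬ T b
T-not⁻ {false} _ ()

∈⇒memℕ : ∀ {i xs} → i ∈ xs → T (memℕ i xs)
∈⇒memℕ {i} i∈xs = any⁺ (i ≡ᵇ_) (Any.map (≡⇒≡ᵇ i _) i∈xs)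

memℕ⇒∈ : ∀ {i} xs → T (memℕ i xs) → i ∈ xs
memℕ⇒∈ {i} xs h = Any.map (≡ᵇ⇒≡ i _) (any⁻ (i ≡ᵇ_) xs h)

Partner : List Event → ℕ → ℕ → Set
Partner es i j = match i j ∈ es ⊎ match j i ∈ es

Partner-sym : ∀ {es i j} → Partner es i j → Partner es j i
Partner-sym = [ inj₂ , inj₁ ]′

Partner⇒matchedIn : ∀ {es i j} → Partner es i j → T (matchedIn es i j)
Partner⇒matchedIn {i = i} {j} (inj₁ m) =
  any⁺ _ (Any.map (λ { refl → from T-∨ (inj₁ (from T-∧ (≡⇒≡ᵇ i i refl , ≡⇒≡ᵇ j j refl))) }) m)
Partner⇒matchedIn {i = i} {j} (inj₂ m) =
  any⁺ _ (Any.map (λ { refl → from T-∨ (inj₂ (from T-∧ (≡⇒≡ᵇ j j refl , ≡⇒≡ᵇ i i refl))) }) m)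

matchedIn⇒Partner : ∀ es {i j} → T (matchedIn es i j) → Partner es i j
matchedIn⇒Partner (match a b ∷ es) {i} {j} h with to T-∨ h
... | inj₂ rest = [ inj₁ ∘ there , inj₂ ∘ there ]′ (matchedIn⇒Partner es rest)
... | inj₁ here-ab with to T-∨ here-ab
...   | inj₁ ab≡ij with to T-∧ ab≡ij
...     | a≡i , b≡j rewrite ≡ᵇ⇒≡ a i a≡i | ≡ᵇ⇒≡ b j b≡j = inj₁ (here refl)
matchedIn⇒Partner (match a b ∷ es) {i} {j} h | inj₁ _ | inj₂ ab≡ji with to T-∧ ab≡ji
...     | a≡j , b≡i rewrite ≡ᵇ⇒≡ a j a≡j | ≡ᵇ⇒≡ b i b≡i = inj₂ (here refl)
matchedIn⇒Partner (del _ ∷ es) h = [ inj₁ ∘ there , inj₂ ∘ there ]′ (matchedIn⇒Partner es h)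

∉-∷ʳ : ∀ {A : Set} {L : List A} {x z} → z ∉ L → z ≢ x → z ∉ L ++ [ x ]
∉-∷ʳ {L = L} z∉L z≢x z∈L++x with ∈-++⁻ L z∈L++x
... | inj₁ z∈L = z∉L z∈L
... | inj₂ (here z≡x) = z≢x z≡x

applyUpTo-cong : ∀ {A : Set} {f g : ℕ → A} → (∀ z → f z ≡ g z) → ∀ m → applyUpTo f m ≡ applyUpTo g m
applyUpTo-cong f≗g zero = refl
applyUpTo-cong f≗g (suc m) = cong₂ _∷_ (f≗g 0) (applyUpTo-cong (f≗g ∘ suc) m)

drop-∷ : ∀ {A : Set} t (xs : List A) → t < length xs → ∃₂ λ e post → drop t xs ≡ e ∷ post
drop-∷ zero (x ∷ xs) _ = x , xs , refl
drop-∷ (suc t) (x ∷ xs) (s≤s t<|xs|) = drop-∷ t xs t<|xs|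

take-suc-drop : ∀ {A : Set} t (xs : List A) {e post} → drop t xs ≡ e ∷ post →
  take (suc t) xs ≡ take t xs ++ [ e ]
take-suc-drop zero (x ∷ xs) refl = refl
take-suc-drop (suc t) (x ∷ xs) eq = cong (x ∷_) (take-suc-drop t xs eq)

drop-∷⇒< : ∀ {A : Set} i (xs : List A) {a rest} → drop i xs ≡ a ∷ rest → i < length xs
drop-∷⇒< zero (x ∷ xs) refl = s≤s z≤n
drop-∷⇒< (suc i) (x ∷ xs) eq = s≤s (drop-∷⇒< i xs eq)

drop-[]⇒≤ : ∀ {A : Set} i (xs : List A) → drop i xs ≡ [] → length xs ≤ i
drop-[]⇒≤ i [] _ = z≤n
drop-[]⇒≤ (suc i) (x ∷ xs) eq = s≤s (drop-[]⇒≤ i xs eq)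

drop-suc : ∀ {A : Set} i (xs : List A) {a rest} → drop i xs ≡ a ∷ rest → drop (suc i) xs ≡ rest
drop-suc zero (x ∷ xs) refl = refl
drop-suc (suc i) (x ∷ xs) eq = drop-suc i xs eq

𝟙 : Bool → ℕ
𝟙 true = 1
𝟙 false = 0

𝟙-mono : ∀ {a b} → (T a → T b) → 𝟙 a ≤ 𝟙 b
𝟙-mono {false} _ = z≤n
𝟙-mono {true} {true} _ = ≤-refl
𝟙-mono {true} {false} a⇒b = ⊥-elim (a⇒b tt)

𝟙-≤-+ : ∀ {a b c} → (T a → T b ⊎ T c) → 𝟙 a ≤ 𝟙 b + 𝟙 c
𝟙-≤-+ {false} _ = z≤n
𝟙-≤-+ {true} {true} _ = s≤s z≤n
𝟙-≤-+ {true} {false} {true} _ = ≤-refl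
𝟙-≤-+ {true} {false} {false} a⇒b∨c = ⊥-elim ([ id , id ]′ (a⇒b∨c tt))

count-∷ : ∀ p x xs → count p (x ∷ xs) ≡ 𝟙 (p x) + count p xs
count-∷ p x xs with p x
... | true = refl
... | false = refl

count-++ : ∀ p xs ys → count p (xs ++ ys) ≡ count p xs + count p ys
count-++ p xs ys = trans (cong length (filter-++ (T? ∘ p) xs ys)) (length-++ (filterᵇ p xs))

count-mono : ∀ p q xs → (∀ z → z ∈ xs → T (p z) → T (q z)) → count p xs ≤ count q xs
count-mono p q [] _ = z≤n
count-mono p q (x ∷ xs) p⇒q = begin
  count p (x ∷ xs)          ≡⟨ count-∷ p x xs ⟩
  𝟙 (p x) + count p xs      ≤⟨ +-mono-≤ (𝟙-mono (p⇒q x (here refl))) (count-mono p q xs (λ z → p⇒q z ∘ there)) ⟩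
  𝟙 (q x) + count q xs      ≡⟨ count-∷ q x xs ⟨
  count q (x ∷ xs)          ∎
  where open ≤-Reasoning

count-≤-+ : ∀ p q r xs → (∀ z → z ∈ xs → T (p z) → T (q z) ⊎ T (r z)) →
  count p xs ≤ count q xs + count r xs
count-≤-+ p q r [] _ = z≤n
count-≤-+ p q r (x ∷ xs) p⇒q∨r = begin
  count p (x ∷ xs)                                ≡⟨ count-∷ p x xs ⟩
  𝟙 (p x) + count p xs                            ≤⟨ +-mono-≤ (𝟙-≤-+ (p⇒q∨r x (here refl)))
                                                       (count-≤-+ p q r xs (λ z → p⇒q∨r z ∘ there)) ⟩
  (𝟙 (q x) + 𝟙 (r x)) + (count q xs + count r xs) ≡⟨ interchange (𝟙 (q x)) (𝟙 (r x)) (count q xs) (count r xs) ⟩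
  (𝟙 (q x) + count q xs) + (𝟙 (r x) + count r xs) ≡⟨ cong₂ _+_ (count-∷ q x xs) (count-∷ r x xs) ⟨
  count q (x ∷ xs) + count r (x ∷ xs)             ∎
  where open ≤-Reasoning

count-< : ∀ p q xs {y} → (∀ z → z ∈ xs → T (p z) → T (q z)) → y ∈ xs → T (q y) → ¬ T (p y) →
  count p xs < count q xs
count-< p q (x ∷ xs) p⇒q (here refl) qx ¬px with p x | q x
... | true | _ = ⊥-elim (¬px tt)
... | false | true = s≤s (count-mono p q xs (λ z → p⇒q z ∘ there))
count-< p q (x ∷ xs) {y} p⇒q (there y∈xs) qy ¬py = begin-strict
  count p (x ∷ xs)      ≡⟨ count-∷ p x xs ⟩
  𝟙 (p x) + count p xs  <⟨ +-monoʳ-< (𝟙 (p x)) (count-< p q xs (λ z → p⇒q z ∘ there) y∈xs qy ¬py) ⟩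
  𝟙 (p x) + count q xs  ≤⟨ +-monoˡ-≤ (count q xs) (𝟙-mono (p⇒q x (here refl))) ⟩
  𝟙 (q x) + count q xs  ≡⟨ count-∷ q x xs ⟨
  count q (x ∷ xs)      ∎
  where open ≤-Reasoning

count-≡0 : ∀ p xs → (∀ z → z ∈ xs → ¬ T (p z)) → count p xs ≡ 0
count-≡0 p [] _ = refl
count-≡0 p (x ∷ xs) ¬p with p x in px
... | true = ⊥-elim (¬p x (here refl) (subst T (sym px) tt))
... | false = count-≡0 p xs (λ z → ¬p z ∘ there)

count-≡ᵇ-≤1 : ∀ {xs} y → Unique xs → count (_≡ᵇ y) xs ≤ 1
count-≡ᵇ-≤1 y [] = z≤n
count-≡ᵇ-≤1 {x ∷ xs} y (x∉xs ∷ unique-xs) with x ≡ᵇ y in x≡ᵇy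
... | false = count-≡ᵇ-≤1 y unique-xs
... | true = s≤s (≤-reflexive (count-≡0 (_≡ᵇ y) xs (λ z z∈xs z≡ᵇy →
  All.lookup x∉xs z∈xs (trans (≡ᵇ⇒≡ x y (subst T (sym x≡ᵇy) tt)) (sym (≡ᵇ⇒≡ z y z≡ᵇy))))))

count-≤-+-length : ∀ p q xs L → Unique xs → (∀ z → z ∈ xs → T (p z) → T (q z) ⊎ z ∈ L) →
  count p xs ≤ count q xs + length L
count-≤-+-length p q xs [] _ p⇒q∨L = begin
  count p xs      ≤⟨ count-mono p q xs (λ z z∈xs → [ id , (λ ()) ]′ ∘ p⇒q∨L z z∈xs) ⟩
  count q xs      ≡⟨ +-identityʳ (count q xs) ⟨
  count q xs + 0  ∎
  where open ≤-Reasoning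
count-≤-+-length p q xs (y ∷ L) unique-xs p⇒q∨yL = begin
  count p xs                        ≤⟨ count-≤-+ p p-y (_≡ᵇ y) xs split ⟩
  count p-y xs + count (_≡ᵇ y) xs   ≤⟨ +-mono-≤ (count-≤-+-length p-y q xs L unique-xs p-y⇒q∨L)
                                                (count-≡ᵇ-≤1 y unique-xs) ⟩
  count q xs + length L + 1         ≡⟨ trans (+-comm _ 1) (sym (+-suc (count q xs) (length L))) ⟩
  count q xs + length (y ∷ L)       ∎
  where
  open ≤-Reasoning
  p-y : ℕ → Bool
  p-y z = p z ∧ not (z ≡ᵇ y)
  split : ∀ z → z ∈ xs → T (p z) → T (p-y z) ⊎ T (z ≡ᵇ y)
  split z _ pz with z ≡ᵇ y
  ... | true = inj₂ tt
  ... | false = inj₁ (from T-∧ (pz , tt))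
  p-y⇒q∨L : ∀ z → z ∈ xs → T (p-y z) → T (q z) ⊎ z ∈ L
  p-y⇒q∨L z z∈xs p-yz with to T-∧ p-yz
  ... | pz , z≢y with p⇒q∨yL z z∈xs pz
  ...   | inj₁ qz = inj₁ qz
  ...   | inj₂ (here refl) = ⊥-elim (T-not⁻ z≢y (≡⇒≡ᵇ z z refl))
  ...   | inj₂ (there z∈L) = inj₂ z∈L

count-memℕ-≤-length : ∀ {xs} D → Unique xs → count (λ z → memℕ z D) xs ≤ length D
count-memℕ-≤-length {xs} D unique-xs = begin
  count (λ z → memℕ z D) xs          ≤⟨ count-≤-+-length _ (λ _ → false) xs D unique-xs (λ _ _ → inj₂ ∘ memℕ⇒∈ D) ⟩
  count (λ _ → false) xs + length D  ≡⟨ cong (_+ length D) (count-≡0 (λ _ → false) xs (λ _ _ ())) ⟩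
  length D                           ∎
  where open ≤-Reasoning

length-deletedIdx : ∀ es → length (deletedIdx es) ≡ numDel es
length-deletedIdx [] = refl
length-deletedIdx (del _ ∷ es) = cong suc (length-deletedIdx es)
length-deletedIdx (match _ _ ∷ es) = length-deletedIdx es

numMatch : List Event → ℕ
numMatch [] = 0
numMatch (match _ _ ∷ es) = suc (numMatch es)
numMatch (del _ ∷ es) = numMatch es

numMatch-++ : ∀ xs ys → numMatch (xs ++ ys) ≡ numMatch xs + numMatch ys
numMatch-++ [] ys = refl
numMatch-++ (match _ _ ∷ xs) ys = cong suc (numMatch-++ xs ys)
numMatch-++ (del _ ∷ xs) ys = numMatch-++ xs ys

touchedBy : List Event → List ℕ
touchedBy = concatMap touched

touchedBy-∷ʳ : ∀ acc e → touchedBy (acc ++ [ e ]) ≡ touchedBy acc ++ touched e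
touchedBy-∷ʳ acc e = trans (concatMap-++ touched acc [ e ]) (cong (touchedBy acc ++_) (++-identityʳ (touched e)))

∈-touchedBy⁺ : ∀ {es e x} → e ∈ es → x ∈ touched e → x ∈ touchedBy es
∈-touchedBy⁺ e∈es x∈e = concatMap⁺ touched (lose e∈es x∈e)

∈-touchedBy⁻ : ∀ {es x} → x ∈ touchedBy es → ∃[ e ] (e ∈ es × x ∈ touched e)
∈-touchedBy⁻ x∈es = find (concatMap⁻ touched x∈es)

∈-touchedBy-∷ʳ⁻ : ∀ acc e {x} → x ∈ touchedBy (acc ++ [ e ]) → x ∈ touchedBy acc ⊎ x ∈ touched e
∈-touchedBy-∷ʳ⁻ acc e x∈ = ∈-++⁻ (touchedBy acc) (subst (_ ∈_) (touchedBy-∷ʳ acc e) x∈)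

∈-touchedBy-∷ʳ⁺ˡ : ∀ acc e {x} → x ∈ touchedBy acc → x ∈ touchedBy (acc ++ [ e ])
∈-touchedBy-∷ʳ⁺ˡ acc e x∈ = subst (_ ∈_) (sym (touchedBy-∷ʳ acc e)) (∈-++⁺ˡ x∈)

∈-touchedBy-∷ʳ⁺ʳ : ∀ acc e {x} → x ∈ touched e → x ∈ touchedBy (acc ++ [ e ])
∈-touchedBy-∷ʳ⁺ʳ acc e x∈ = subst (_ ∈_) (sym (touchedBy-∷ʳ acc e)) (∈-++⁺ʳ (touchedBy acc) x∈)

del∈⇒deletedIdx : ∀ {es x} → del x ∈ es → x ∈ deletedIdx es
del∈⇒deletedIdx {del _ ∷ _} (here refl) = here refl
del∈⇒deletedIdx {del _ ∷ _} (there m) = there (del∈⇒deletedIdx m)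
del∈⇒deletedIdx {match _ _ ∷ _} (there m) = del∈⇒deletedIdx m

deletedIdx⇒del∈ : ∀ es {x} → x ∈ deletedIdx es → del x ∈ es
deletedIdx⇒del∈ (del _ ∷ _) (here refl) = here refl
deletedIdx⇒del∈ (del _ ∷ es) (there m) = there (deletedIdx⇒del∈ es m)
deletedIdx⇒del∈ (match _ _ ∷ es) m = there (deletedIdx⇒del∈ es m)

length-touchedBy : ∀ es → length (touchedBy es) ≡ numDel es + 2 * numMatch es
length-touchedBy [] = refl
length-touchedBy (del _ ∷ es) = cong suc (length-touchedBy es)
length-touchedBy (match _ _ ∷ es) = trans (cong (2 +_) (length-touchedBy es)) (shift (numDel es) (numMatch es))
  where
  shift : ∀ d m → 2 + (d + 2 * m) ≡ d + 2 * suc m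
  shift = solve-∀

A-suc : ∀ es t {e post} → drop t es ≡ e ∷ post → A es (suc t) ≡ A es t ++ touched e
A-suc es t {e} eq = trans (cong touchedBy (take-suc-drop t es eq)) (touchedBy-∷ʳ (take t es) e)

-- Edit distance

==S-refl : ∀ {k} (x : Sym k) → (x ==S x) ≡ true
==S-refl (op a) = dec-true (a ≟F a) refl
==S-refl (cl a) = dec-true (a ≟F a) refl

editDist-∷ʳ : ∀ {k} (ys : List (Sym k)) x xs → editDist ys (x ∷ xs) ≤ suc (editDist ys xs)
editDist-∷ʳ [] x xs = ≤-refl
editDist-∷ʳ (y ∷ ys) x xs = ≤-trans (m⊓n≤m _ _) (m⊓n≤n _ _)

editDist-∷-∷ : ∀ {k} (x : Sym k) ys xs → editDist (x ∷ ys) (x ∷ xs) ≤ editDist ys xs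
editDist-∷-∷ x ys xs = begin
  editDist (x ∷ ys) (x ∷ xs)                   ≤⟨ m⊓n≤n _ _ ⟩
  editDist ys xs + (if x ==S x then 0 else 1)  ≡⟨ cong (λ b → editDist ys xs + (if b then 0 else 1)) (==S-refl x) ⟩
  editDist ys xs + 0                           ≡⟨ +-identityʳ _ ⟩
  editDist ys xs                               ∎
  where open ≤-Reasoning

editDist-removeFrom : ∀ {k} D (xs : List (Sym k)) i →
  editDist (removeFrom i D xs) xs ≤ count (λ z → memℕ z D) (applyUpTo (i +_) (length xs))
editDist-removeFrom D [] i = z≤n
editDist-removeFrom D (x ∷ xs) i = begin
  editDist (removeFrom i D (x ∷ xs)) (x ∷ xs)       ≤⟨ first-position ⟩
  𝟙 (memℕ i D) + count deleted (positions (suc i))  ≡⟨ shift ⟨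
  count deleted (applyUpTo (i +_) (length (x ∷ xs))) ∎
  where
  open ≤-Reasoning
  deleted : ℕ → Bool
  deleted z = memℕ z D
  positions : ℕ → List ℕ
  positions j = applyUpTo (j +_) (length xs)
  shift : count deleted (applyUpTo (i +_) (length (x ∷ xs))) ≡ 𝟙 (memℕ i D) + count deleted (positions (suc i))
  shift = trans (count-∷ deleted (i + 0) _)
    (cong₂ (λ j l → 𝟙 (memℕ j D) + count deleted l) (+-identityʳ i) (applyUpTo-cong (+-suc i) (length xs)))
  rest : editDist (removeFrom (suc i) D xs) xs ≤ count deleted (positions (suc i))
  rest = editDist-removeFrom D xs (suc i)
  first-position : editDist (removeFrom i D (x ∷ xs)) (x ∷ xs) ≤ 𝟙 (memℕ i D) + count deleted (positions (suc i))
  first-position with memℕ i D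
  ... | true = ≤-trans (editDist-∷ʳ (removeFrom (suc i) D xs) x xs) (s≤s rest)
  ... | false = ≤-trans (editDist-∷-∷ x (removeFrom (suc i) D xs) xs) rest

editDist-finalString : ∀ {k} c (σ : List (Sym k)) → editDist (finalString c σ) σ ≤ numDel (trace c σ)
editDist-finalString c σ = begin
  editDist (finalString c σ) σ                   ≤⟨ editDist-removeFrom D σ 0 ⟩
  count (λ z → memℕ z D) (upTo (length σ))       ≤⟨ count-memℕ-≤-length D (upTo⁺ (length σ)) ⟩
  length D                                       ≡⟨ length-deletedIdx (trace c σ) ⟩
  numDel (trace c σ)                             ∎
  where
  open ≤-Reasoning
  D : List ℕ
  D = deletedIdx (trace c σ)

-- The potential argument

record Partition (n : ℕ) (opt : List Event) : Set where
  field
    partner-unique : ∀ {x y z} → Partner opt x y → Partner opt x z → y ≡ z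
    partner-irreflexive : ∀ {x} → ¬ Partner opt x x
    partner-< : ∀ {x y} → Partner opt x y → y < n
    partnered⇒undeleted : ∀ {x y} → Partner opt x y → x ∉ deletedIdx opt
    deleted-or-partnered : ∀ {x} → x < n → x ∈ deletedIdx opt ⊎ ∃ (Partner opt x)

Untangled : List Event → List ℕ → ℕ → ℕ → Set
Untangled opt L j i = ¬ Partner opt j i → ∀ {p q} → Partner opt j p → Partner opt i q → p ∈ L ⊎ q ∈ L

Admissible : ℕ → List Event → List ℕ → Event → Set
Admissible n opt L (del x) = x ∉ L × x < n
Admissible n opt L (match j i) = j ∉ L × i ∉ L × j < n × i < n × j ≢ i × Untangled opt L j i

module Potential {n opt} (partition : Partition n opt) where
  open Partition partition

  Del : List ℕ
  Del = deletedIdx opt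

  PartneredIn : List ℕ → ℕ → Set
  PartneredIn L z = ∃[ y ] (y ∈ L × Partner opt z y)

  Reached : List ℕ → ℕ → Set
  Reached L z = z ∈ L ⊎ PartneredIn L z

  Settled : List ℕ → ℕ → Set
  Settled L u = u ∈ Del ⊎ PartneredIn L u

  inPotential : List ℕ → ℕ → Bool
  inPotential L z = not (memℕ z Del) ∧ (memℕ z L ∨ any (matchedIn opt z) L)

  potential : List ℕ → ℕ
  potential L = count (inPotential L) (upTo n)

  inGap : List ℕ → ℕ → Bool
  inGap L z = not (memℕ z L) ∧ any (matchedIn opt z) L

  gapSize : List ℕ → ℕ
  gapSize L = count (inGap L) (upTo n)

  PartneredIn⇒any : ∀ {L z} → PartneredIn L z → T (any (matchedIn opt z) L)
  PartneredIn⇒any (y , y∈L , z~y) = any⁺ _ (lose y∈L (Partner⇒matchedIn z~y))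

  any⇒PartneredIn : ∀ {L z} → T (any (matchedIn opt z) L) → PartneredIn L z
  any⇒PartneredIn {L} h with find (any⁻ _ L h)
  ... | y , y∈L , z~y = y , y∈L , matchedIn⇒Partner opt z~y

  inPotential⁺ : ∀ {L z} → z ∉ Del → Reached L z → T (inPotential L z)
  inPotential⁺ z∉Del reached = from T-∧ (T-not⁺ (z∉Del ∘ memℕ⇒∈ Del) ,
    from T-∨ ([ inj₁ ∘ ∈⇒memℕ , inj₂ ∘ PartneredIn⇒any ]′ reached))

  inPotential⁻ : ∀ {L z} → T (inPotential L z) → z ∉ Del × Reached L z
  inPotential⁻ {L} h with to T-∧ h
  ... | z∉Del , reached = T-not⁻ z∉Del ∘ ∈⇒memℕ , [ inj₁ ∘ memℕ⇒∈ L , inj₂ ∘ any⇒PartneredIn ]′ (to T-∨ reached)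

  inGap⁺ : ∀ {L z} → z ∉ L → PartneredIn L z → T (inGap L z)
  inGap⁺ {L} z∉L partnered = from T-∧ (T-not⁺ (z∉L ∘ memℕ⇒∈ L) , PartneredIn⇒any partnered)

  inGap⁻ : ∀ {L z} → T (inGap L z) → z ∉ L × PartneredIn L z
  inGap⁻ h with to T-∧ h
  ... | z∉L , partnered = T-not⁻ z∉L ∘ ∈⇒memℕ , any⇒PartneredIn partnered

  Reached-++ : ∀ L S {z} → Reached (L ++ S) z → Reached L z ⊎ Reached S z
  Reached-++ L S (inj₁ z∈L++S) = [ inj₁ ∘ inj₁ , inj₂ ∘ inj₁ ]′ (∈-++⁻ L z∈L++S)
  Reached-++ L S (inj₂ (y , y∈L++S , z~y)) =
    [ (λ y∈L → inj₁ (inj₂ (y , y∈L , z~y))) , (λ y∈S → inj₂ (inj₂ (y , y∈S , z~y))) ]′ (∈-++⁻ L y∈L++S)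

  Reached-[] : ∀ {u z} → Reached [ u ] z → z ≡ u ⊎ Partner opt z u
  Reached-[] (inj₁ (here z≡u)) = inj₁ z≡u
  Reached-[] (inj₂ (y , here refl , z~u)) = inj₂ z~u

  Covers : List ℕ → List ℕ → List ℕ → Set
  Covers L Lu S = ∀ z → z ∉ Del → Reached S z → Reached L z ⊎ z ∈ Lu

  potential-++-≤ : ∀ L S Lu {m} → Covers L Lu S → length Lu ≤ m → potential (L ++ S) ≤ potential L + m
  potential-++-≤ L S Lu covers |Lu|≤m =
    ≤-trans (count-≤-+-length _ _ (upTo n) Lu (upTo⁺ n) new-in-Lu) (+-monoʳ-≤ (potential L) |Lu|≤m)
    where
    new-in-Lu : ∀ z → z ∈ upTo n → T (inPotential (L ++ S) z) → T (inPotential L z) ⊎ z ∈ Lu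
    new-in-Lu z _ h with inPotential⁻ h
    ... | z∉Del , reached with Reached-++ L S reached
    ...   | inj₁ reached-L = inj₁ (inPotential⁺ z∉Del reached-L)
    ...   | inj₂ reached-S = [ inj₁ ∘ inPotential⁺ z∉Del , inj₂ ]′ (covers z z∉Del reached-S)

  Covers-++ : ∀ {L Lu} S S' → Covers L Lu S → Covers L Lu S' → Covers L Lu (S ++ S')
  Covers-++ S S' covers covers' z z∉Del reached = [ covers z z∉Del , covers' z z∉Del ]′ (Reached-++ S S' reached)

  Settled⇒Covers : ∀ {L u} Lu → Settled L u → Covers L Lu [ u ]
  Settled⇒Covers Lu settled z z∉Del reached with Reached-[] reached | settled
  ... | inj₁ refl | inj₁ u∈Del = ⊥-elim (z∉Del u∈Del)
  ... | inj₁ refl | inj₂ partnered = inj₁ (inj₂ partnered)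
  ... | inj₂ z~u | inj₁ u∈Del = ⊥-elim (partnered⇒undeleted (Partner-sym z~u) u∈Del)
  ... | inj₂ z~u | inj₂ (p , p∈L , u~p) rewrite partner-unique (Partner-sym z~u) u~p = inj₁ (inj₁ p∈L)

  Partner⇒Covers : ∀ {L Lu u v} → Partner opt u v → u ∈ Lu → v ∈ Lu → Covers L Lu [ u ]
  Partner⇒Covers u~v u∈Lu v∈Lu z _ reached with Reached-[] reached
  ... | inj₁ refl = inj₂ u∈Lu
  ... | inj₂ z~u rewrite partner-unique (Partner-sym z~u) u~v = inj₂ v∈Lu

  neighbourhood : ∀ {u} → u < n → ∃[ Lu ] (length Lu ≤ 2 × ∀ {L} → Covers L Lu [ u ])
  neighbourhood {u} u<n with deleted-or-partnered u<n
  ... | inj₁ u∈Del = [ u ] , s≤s z≤n , (λ z _ reached → inj₂ (only-u z reached))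
    where
    only-u : ∀ z → Reached [ u ] z → z ∈ [ u ]
    only-u z reached with Reached-[] reached
    ... | inj₁ refl = here refl
    ... | inj₂ z~u = ⊥-elim (partnered⇒undeleted (Partner-sym z~u) u∈Del)
  ... | inj₂ (v , u~v) = u ∷ v ∷ [] , ≤-refl , Partner⇒Covers u~v (here refl) (there (here refl))

  settled-or-outstanding : ∀ L {u} → u < n → Settled L u ⊎ ∃[ p ] (Partner opt u p × p ∉ L)
  settled-or-outstanding L u<n with deleted-or-partnered u<n
  ... | inj₁ u∈Del = inj₁ (inj₁ u∈Del)
  ... | inj₂ (p , u~p) with p ∈? L
  ...   | yes p∈L = inj₁ (inj₂ (p , p∈L , u~p))
  ...   | no p∉L = inj₂ (p , u~p , p∉L)

  potential-del : ∀ L {x} → x ∉ L → x < n →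
    potential (L ++ [ x ]) ≤ potential L ⊎
    (potential (L ++ [ x ]) ≤ potential L + 2 × gapSize L < gapSize (L ++ [ x ]))
  potential-del L {x} x∉L x<n with settled-or-outstanding L x<n
  ... | inj₁ settled =
    inj₁ (≤-trans (potential-++-≤ L [ x ] [] (Settled⇒Covers [] settled) z≤n) (≤-reflexive (+-identityʳ _)))
  ... | inj₂ (y , x~y , y∉L) =
    inj₂ (potential-++-≤ L [ x ] (x ∷ y ∷ []) (Partner⇒Covers x~y (here refl) (there (here refl))) ≤-refl ,
          count-< (inGap L) (inGap (L ++ [ x ])) (upTo n) still-in-gap (∈-upTo⁺ (partner-< x~y)) y-enters y-was-out)
    where
    still-in-gap : ∀ z → z ∈ upTo n → T (inGap L z) → T (inGap (L ++ [ x ]) z)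
    still-in-gap z _ h with inGap⁻ h
    ... | z∉L , (w , w∈L , z~w) = inGap⁺ (∉-∷ʳ z∉L z≢x) (w , ∈-++⁺ˡ w∈L , z~w)
      where
      z≢x : z ≢ x
      z≢x refl = y∉L (subst (_∈ L) (partner-unique z~w x~y) w∈L)
    y-enters : T (inGap (L ++ [ x ]) y)
    y-enters = inGap⁺ (∉-∷ʳ y∉L λ { refl → partner-irreflexive x~y }) (x , ∈-++⁺ʳ L (here refl) , Partner-sym x~y)
    y-was-out : ¬ T (inGap L y)
    y-was-out h with inGap⁻ h
    ... | _ , (w , w∈L , y~w) = x∉L (subst (_∈ L) (partner-unique y~w (Partner-sym x~y)) w∈L)

  potential-match : ∀ L {j i} → Admissible n opt L (match j i) → potential (L ++ j ∷ i ∷ []) ≤ potential L + 2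
  potential-match L {j} {i} (_ , _ , j<n , i<n , _ , untangled)
    with T? (matchedIn opt j i) | settled-or-outstanding L j<n | settled-or-outstanding L i<n
  ... | yes j~i | _ | _ = potential-++-≤ L (j ∷ i ∷ []) (j ∷ i ∷ [])
        (Covers-++ [ j ] [ i ] (Partner⇒Covers (matchedIn⇒Partner opt j~i) (here refl) (there (here refl)))
                               (Partner⇒Covers (Partner-sym (matchedIn⇒Partner opt j~i)) (there (here refl))
                                               (here refl)))
        ≤-refl
  ... | no _ | inj₁ settled-j | _ =
    let Lu , |Lu|≤2 , covers-i = neighbourhood i<n
    in potential-++-≤ L (j ∷ i ∷ []) Lu (Covers-++ [ j ] [ i ] (Settled⇒Covers Lu settled-j) covers-i) |Lu|≤2
  ... | no _ | inj₂ _ | inj₁ settled-i =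
    let Lu , |Lu|≤2 , covers-j = neighbourhood j<n
    in potential-++-≤ L (j ∷ i ∷ []) Lu (Covers-++ [ j ] [ i ] covers-j (Settled⇒Covers Lu settled-i)) |Lu|≤2
  ... | no ¬j~i | inj₂ (p , j~p , p∉L) | inj₂ (q , i~q , q∉L) =
    ⊥-elim ([ p∉L , q∉L ]′ (untangled (¬j~i ∘ Partner⇒matchedIn) j~p i~q))

  occupied : List ℕ → ℕ
  occupied L = count (λ z → memℕ z L) (upTo n)

  length-≤-occupied-++ : ∀ L {x} → length L ≤ occupied L → x ∉ L → x < n →
    length (L ++ [ x ]) ≤ occupied (L ++ [ x ])
  length-≤-occupied-++ L {x} |L|≤occ x∉L x<n = begin
    length (L ++ [ x ])    ≡⟨ trans (length-++ L) (+-comm (length L) 1) ⟩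
    suc (length L)         ≤⟨ s≤s |L|≤occ ⟩
    suc (occupied L)       ≤⟨ count-< (λ z → memℕ z L) (λ z → memℕ z (L ++ [ x ])) (upTo n)
                                (λ z _ → ∈⇒memℕ ∘ ∈-++⁺ˡ ∘ memℕ⇒∈ {z} L) (∈-upTo⁺ x<n)
                                (∈⇒memℕ (∈-++⁺ʳ L (here refl))) (x∉L ∘ memℕ⇒∈ L) ⟩
    occupied (L ++ [ x ])  ∎
    where open ≤-Reasoning

  occupied-≤-potential : ∀ L → occupied L ≤ potential L + length Del
  occupied-≤-potential L = count-≤-+-length _ _ (upTo n) Del (upTo⁺ n) deleted-or-counted
    where
    deleted-or-counted : ∀ z → z ∈ upTo n → T (memℕ z L) → T (inPotential L z) ⊎ z ∈ Del
    deleted-or-counted z _ z∈L with z ∈? Del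
    ... | yes z∈Del = inj₂ z∈Del
    ... | no z∉Del = inj₁ (inPotential⁺ z∉Del (inj₁ (memℕ⇒∈ L z∈L)))

  module _ (es : List Event) (admissible : ∀ t {e post} → drop t es ≡ e ∷ post → Admissible n opt (A es t) e) where

    wrong : ℕ → Bool
    wrong t = delAt es (suc t) ∧ (gap n opt es t <ᵇ gap n opt es (suc t))

    wrongBefore : ℕ → ℕ
    wrongBefore t = count wrong (upTo t)

    wrongBefore-suc : ∀ t → wrongBefore (suc t) ≡ wrongBefore t + 𝟙 (wrong t)
    wrongBefore-suc t = begin
      count wrong (upTo (suc t))        ≡⟨ cong (count wrong) (upTo-∷ʳ t) ⟨
      count wrong (upTo t ++ [ t ])     ≡⟨ count-++ wrong (upTo t) [ t ] ⟩
      wrongBefore t + count wrong [ t ] ≡⟨ cong (wrongBefore t +_) (trans (count-∷ wrong t []) (+-identityʳ _)) ⟩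
      wrongBefore t + 𝟙 (wrong t)       ∎
      where open ≡-Reasoning

    wrong-del : ∀ t {x post} → drop t es ≡ del x ∷ post →
      gapSize (A es t) < gapSize (A es t ++ [ x ]) → 𝟙 (wrong t) ≡ 1
    wrong-del t eq grows = cong 𝟙 (to T-≡ (from T-∧ (deletion , gap-grows)))
      where
      deletion : T (delAt es (suc t))
      deletion = subst (λ l → T (any isDel (take 1 l))) (sym eq) tt
      gap-grows : T (gap n opt es t <ᵇ gap n opt es (suc t))
      gap-grows = subst (λ L → T (gapSize (A es t) <ᵇ gapSize L)) (sym (A-suc es t eq)) (<⇒<ᵇ grows)

    potential-suc : ∀ t {e post} → drop t es ≡ e ∷ post →
      potential (A es (suc t)) ≤ potential (A es t) + 2 * (numMatch [ e ] + 𝟙 (wrong t))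
    potential-suc t {e} eq =
      subst (λ L → potential L ≤ potential (A es t) + 2 * (numMatch [ e ] + 𝟙 (wrong t))) (sym (A-suc es t eq))
        (step e eq)
      where
      step : ∀ e {post} → drop t es ≡ e ∷ post →
        potential (A es t ++ touched e) ≤ potential (A es t) + 2 * (numMatch [ e ] + 𝟙 (wrong t))
      step (del x) eq with admissible t eq
      ... | x∉A , x<n with potential-del (A es t) x∉A x<n
      ...   | inj₁ unchanged = ≤-trans unchanged (m≤m+n _ _)
      ...   | inj₂ (grows-by-2 , gap-grows) =
        ≤-trans grows-by-2 (≤-reflexive (cong (λ w → potential (A es t) + 2 * w) (sym (wrong-del t eq gap-grows))))
      step (match j i) eq =
        ≤-trans (potential-match (A es t) (admissible t eq)) (+-monoʳ-≤ _ (*-monoʳ-≤ 2 (s≤s z≤n)))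

    potential-bound : ∀ t → t ≤ length es → potential (A es t) ≤ 2 * (numMatch (take t es) + wrongBefore t)
    potential-bound zero _ =
      ≤-reflexive (count-≡0 _ (upTo n) (λ z _ h → nothing-reached (proj₂ (inPotential⁻ {[]} {z} h))))
      where
      nothing-reached : ∀ {z} → ¬ Reached [] z
      nothing-reached (inj₂ (_ , () , _))
    potential-bound (suc t) t<|es| with drop-∷ t es t<|es|
    ... | e , post , eq = begin
      potential (A es (suc t))                                ≤⟨ potential-suc t eq ⟩
      potential (A es t) + 2 * (numMatch [ e ] + 𝟙 (wrong t))  ≤⟨ +-monoˡ-≤ _ (potential-bound t (<⇒≤ t<|es|)) ⟩
      2 * (M + W) + 2 * (numMatch [ e ] + 𝟙 (wrong t))        ≡⟨ regroup M W (numMatch [ e ]) (𝟙 (wrong t)) ⟩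
      2 * ((M + numMatch [ e ]) + (W + 𝟙 (wrong t)))          ≡⟨ cong₂ (λ m w → 2 * (m + w)) matches-suc
                                                                          (wrongBefore-suc t) ⟨
      2 * (numMatch (take (suc t) es) + wrongBefore (suc t))  ∎
      where
      open ≤-Reasoning
      M W : ℕ
      M = numMatch (take t es)
      W = wrongBefore t
      regroup : ∀ m w m′ w′ → 2 * (m + w) + 2 * (m′ + w′) ≡ 2 * ((m + m′) + (w + w′))
      regroup = solve-∀
      matches-suc : numMatch (take (suc t) es) ≡ M + numMatch [ e ]
      matches-suc = trans (cong numMatch (take-suc-drop t es eq)) (numMatch-++ (take t es) [ e ])

    length-≤-occupied : ∀ t → t ≤ length es → length (A es t) ≤ occupied (A es t)
    length-≤-occupied zero _ = z≤n
    length-≤-occupied (suc t) t<|es| with drop-∷ t es t<|es|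
    ... | e , post , eq =
      subst (λ L → length L ≤ occupied L) (sym (A-suc es t eq)) (step e eq (length-≤-occupied t (<⇒≤ t<|es|)))
      where
      L : List ℕ
      L = A es t
      step : ∀ e {post} → drop t es ≡ e ∷ post → length L ≤ occupied L →
        length (L ++ touched e) ≤ occupied (L ++ touched e)
      step (del x) eq |L|≤occ with admissible t eq
      ... | x∉L , x<n = length-≤-occupied-++ L |L|≤occ x∉L x<n
      step (match j i) eq |L|≤occ with admissible t eq
      ... | j∉L , i∉L , j<n , i<n , j≢i , _ =
        subst (λ L' → length L' ≤ occupied L') (++-assoc L [ j ] [ i ])
          (length-≤-occupied-++ (L ++ [ j ]) (length-≤-occupied-++ L |L|≤occ j∉L j<n)
                                (∉-∷ʳ i∉L (j≢i ∘ sym)) i<n)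

    deletions-bound : numDel es ≤ numDel opt + 2 * wrongMoves n opt es
    deletions-bound = +-cancelˡ-≤ (2 * M) _ _ (begin
      2 * M + numDel es                          ≡⟨ +-comm (2 * M) (numDel es) ⟩
      numDel es + 2 * M                          ≡⟨ cong (λ es′ → numDel es′ + 2 * M) (take-all _ es ≤-refl) ⟨
      numDel all + 2 * M                         ≡⟨ length-touchedBy all ⟨
      length (A es (length es))                  ≤⟨ length-≤-occupied (length es) ≤-refl ⟩
      occupied (A es (length es))                ≤⟨ occupied-≤-potential (A es (length es)) ⟩
      potential (A es (length es)) + length Del  ≤⟨ +-mono-≤ (potential-bound (length es) ≤-refl)
                                                              (≤-reflexive (length-deletedIdx opt)) ⟩
      2 * (M + W) + numDel opt                   ≡⟨ rearrange M W (numDel opt) ⟩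
      2 * M + (numDel opt + 2 * W)               ∎)
      where
      open ≤-Reasoning
      all : List Event
      all = take (length es) es
      M W : ℕ
      M = numMatch all
      W = wrongBefore (length es)
      rearrange : ∀ m w d → 2 * (m + w) + d ≡ 2 * m + (d + 2 * w)
      rearrange = solve-∀

-- Stack scans

module Traces {k} (σ : List (Sym k)) where

  n : ℕ
  n = length σ

  OpenAt CloseAt : ℕ → Set
  OpenAt x = ∃₂ λ a rest → drop x σ ≡ op a ∷ rest
  CloseAt x = ∃₂ λ a rest → drop x σ ≡ cl a ∷ rest

  OpenAt⇒¬CloseAt : ∀ {x} → OpenAt x → ¬ CloseAt x
  OpenAt⇒¬CloseAt (_ , _ , open-x) (_ , _ , close-x) with trans (sym open-x) close-x
  ... | ()

  Fresh : List Event → Event → Set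
  Fresh acc e = ∀ {x} → x ∈ touched e → x ∉ touchedBy acc × x < n

  record Nested (acc : List Event) (j i : ℕ) : Set where
    field
      j<i : j < i
      open-j : OpenAt j
      close-i : CloseAt i
      unprocessed⇒stacked : ∀ {x} → x < i → x ∉ touchedBy acc → OpenAt x × x ≤ j
      processed⇒< : ∀ {x} → x ∈ touchedBy acc → x < i

  Legal : List Event → Event → Set
  Legal acc (del x) = Fresh acc (del x)
  Legal acc (match j i) = Fresh acc (match j i) × Nested acc j i

  Legal⇒Fresh : ∀ {acc} e → Legal acc e → Fresh acc e
  Legal⇒Fresh (del _) fresh = fresh
  Legal⇒Fresh (match _ _) (fresh , _) = fresh

  data AllLegal (acc : List Event) : List Event → Set where
    [] : AllLegal acc []
    _∷_ : ∀ {e es} → Legal acc e → AllLegal (acc ++ [ e ]) es → AllLegal acc (e ∷ es)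

  AllLegal-++ : ∀ {acc} xs {ys} → AllLegal acc xs → AllLegal (acc ++ xs) ys → AllLegal acc (xs ++ ys)
  AllLegal-++ {acc} [] [] legal-ys = subst (λ a → AllLegal a _) (++-identityʳ acc) legal-ys
  AllLegal-++ {acc} (x ∷ xs) (legal-x ∷ legal-xs) legal-ys =
    legal-x ∷ AllLegal-++ xs legal-xs (subst (λ a → AllLegal a _) (sym (++-assoc acc [ x ] xs)) legal-ys)

  AllLegal-drop : ∀ {acc es} → AllLegal acc es → ∀ t {e post} → drop t es ≡ e ∷ post →
    Legal (acc ++ take t es) e
  AllLegal-drop {acc} (legal-e ∷ _) zero refl = subst (λ a → Legal a _) (sym (++-identityʳ acc)) legal-e
  AllLegal-drop {acc} {x ∷ es} (_ ∷ legal-es) (suc t) eq =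
    subst (λ a → Legal a _) (++-assoc acc [ x ] (take t es)) (AllLegal-drop legal-es t eq)

  AllLegal-∈ : ∀ {acc es e} → AllLegal acc es → e ∈ es →
    ∃[ pre ] (Legal (acc ++ pre) e × (∀ {e′} → e′ ∈ pre → e′ ∈ es))
  AllLegal-∈ {acc} (legal-e ∷ _) (here refl) = [] , subst (λ a → Legal a _) (sym (++-identityʳ acc)) legal-e , λ ()
  AllLegal-∈ {acc} {x ∷ es} (_ ∷ legal-es) (there e∈es) with AllLegal-∈ legal-es e∈es
  ... | pre , legal-e , pre⊆es =
    x ∷ pre , subst (λ a → Legal a _) (++-assoc acc [ x ] pre) legal-e ,
    λ { (here refl) → here refl ; (there m) → there (pre⊆es m) }

  AllLegal-fresh : ∀ {acc es e x} → AllLegal acc es → e ∈ es → x ∈ touched e → x ∉ touchedBy acc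
  AllLegal-fresh {e = e} (legal-e ∷ _) (here refl) x∈e = proj₁ (Legal⇒Fresh e legal-e x∈e)
  AllLegal-fresh {acc} {y ∷ es} (_ ∷ legal-es) (there e∈es) x∈e =
    AllLegal-fresh legal-es e∈es x∈e ∘ ∈-touchedBy-∷ʳ⁺ˡ acc y

  AllLegal-disjoint : ∀ {acc es e₁ e₂ x} → AllLegal acc es → e₁ ∈ es → e₂ ∈ es →
    x ∈ touched e₁ → x ∈ touched e₂ → e₁ ≡ e₂
  AllLegal-disjoint _ (here refl) (here refl) _ _ = refl
  AllLegal-disjoint {acc} {e ∷ _} (_ ∷ legal-es) (here refl) (there e₂∈es) x∈e₁ x∈e₂ =
    ⊥-elim (AllLegal-fresh legal-es e₂∈es x∈e₂ (∈-touchedBy-∷ʳ⁺ʳ acc e x∈e₁))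
  AllLegal-disjoint {acc} {e ∷ _} (_ ∷ legal-es) (there e₁∈es) (here refl) x∈e₁ x∈e₂ =
    ⊥-elim (AllLegal-fresh legal-es e₁∈es x∈e₁ (∈-touchedBy-∷ʳ⁺ʳ acc e x∈e₂))
  AllLegal-disjoint (_ ∷ legal-es) (there e₁∈es) (there e₂∈es) x∈e₁ x∈e₂ =
    AllLegal-disjoint legal-es e₁∈es e₂∈es x∈e₁ x∈e₂

  indices : Stack k → List ℕ
  indices = map proj₁

  record Invariant (acc : List Event) (i : ℕ) (s : Stack k) : Set where
    field
      i≤n : i ≤ n
      processed⇒ : ∀ {x} → x ∈ touchedBy acc → x < i × x ∉ indices s
      processed-or-stacked : ∀ {x} → x < i → x ∉ indices s → x ∈ touchedBy acc
      stacked⇒ : ∀ {x} → x ∈ indices s → x < i × OpenAt x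
      descending : AllPairs _>_ (indices s)
  open Invariant

  delete-top : ∀ {acc i j b s} → Invariant acc i ((j , b) ∷ s) →
    Legal acc (del j) × Invariant (acc ++ [ del j ]) i s
  delete-top {acc} {i} {j} {b} {s} inv = fresh , record
    { i≤n = i≤n inv
    ; processed⇒ = processed
    ; processed-or-stacked = processed-or-stacked′
    ; stacked⇒ = stacked⇒ inv ∘ there
    ; descending = AllPairs.tail (descending inv)
    }
    where
    j<i : j < i
    j<i = proj₁ (stacked⇒ inv (here refl))
    s<j : All (j >_) (indices s)
    s<j = AllPairs.head (descending inv)
    fresh : Fresh acc (del j)
    fresh (here refl) = (λ j∈acc → proj₂ (processed⇒ inv j∈acc) (here refl)) , <-≤-trans j<i (i≤n inv)
    processed : ∀ {x} → x ∈ touchedBy (acc ++ [ del j ]) → x < i × x ∉ indices s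
    processed x∈ with ∈-touchedBy-∷ʳ⁻ acc (del j) x∈
    ... | inj₁ x∈acc = proj₁ (processed⇒ inv x∈acc) , proj₂ (processed⇒ inv x∈acc) ∘ there
    ... | inj₂ (here refl) = j<i , λ j∈s → <-irrefl refl (All.lookup s<j j∈s)
    processed-or-stacked′ : ∀ {x} → x < i → x ∉ indices s → x ∈ touchedBy (acc ++ [ del j ])
    processed-or-stacked′ {x} x<i x∉s with x ≟ j
    ... | yes refl = ∈-touchedBy-∷ʳ⁺ʳ acc (del j) (here refl)
    ... | no x≢j = ∈-touchedBy-∷ʳ⁺ˡ acc (del j)
      (processed-or-stacked inv x<i λ { (here x≡j) → x≢j x≡j ; (there x∈s) → x∉s x∈s })

  delete-current : ∀ {acc i s y rest} → Invariant acc i s → drop i σ ≡ y ∷ rest →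
    Legal acc (del i) × Invariant (acc ++ [ del i ]) (suc i) s
  delete-current {acc} {i} {s} inv eq = fresh , record
    { i≤n = i<n
    ; processed⇒ = processed
    ; processed-or-stacked = processed-or-stacked′
    ; stacked⇒ = λ x∈s → m≤n⇒m≤1+n (proj₁ (stacked⇒ inv x∈s)) , proj₂ (stacked⇒ inv x∈s)
    ; descending = descending inv
    }
    where
    i<n : i < n
    i<n = drop-∷⇒< i σ eq
    fresh : Fresh acc (del i)
    fresh (here refl) = (λ i∈acc → <-irrefl refl (proj₁ (processed⇒ inv i∈acc))) , i<n
    processed : ∀ {x} → x ∈ touchedBy (acc ++ [ del i ]) → x < suc i × x ∉ indices s
    processed x∈ with ∈-touchedBy-∷ʳ⁻ acc (del i) x∈
    ... | inj₁ x∈acc = m≤n⇒m≤1+n (proj₁ (processed⇒ inv x∈acc)) , proj₂ (processed⇒ inv x∈acc)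
    ... | inj₂ (here refl) = ≤-refl , λ i∈s → <-irrefl refl (proj₁ (stacked⇒ inv i∈s))
    processed-or-stacked′ : ∀ {x} → x < suc i → x ∉ indices s → x ∈ touchedBy (acc ++ [ del i ])
    processed-or-stacked′ {x} x≤i x∉s with x ≟ i
    ... | yes refl = ∈-touchedBy-∷ʳ⁺ʳ acc (del i) (here refl)
    ... | no x≢i = ∈-touchedBy-∷ʳ⁺ˡ acc (del i) (processed-or-stacked inv (≤∧≢⇒< (s≤s⁻¹ x≤i) x≢i) x∉s)

  push : ∀ {acc i s a rest} → Invariant acc i s → drop i σ ≡ op a ∷ rest → Invariant acc (suc i) ((i , a) ∷ s)
  push {acc} {i} {s} {a} inv eq = record
    { i≤n = drop-∷⇒< i σ eq
    ; processed⇒ = λ x∈acc → m≤n⇒m≤1+n (proj₁ (processed⇒ inv x∈acc)) , not-stacked x∈acc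
    ; processed-or-stacked = processed-or-stacked′
    ; stacked⇒ = stacked
    ; descending = All.tabulate (proj₁ ∘ stacked⇒ inv) ∷ descending inv
    }
    where
    not-stacked : ∀ {x} → x ∈ touchedBy acc → x ∉ indices ((i , a) ∷ s)
    not-stacked x∈acc (here refl) = <-irrefl refl (proj₁ (processed⇒ inv x∈acc))
    not-stacked x∈acc (there x∈s) = proj₂ (processed⇒ inv x∈acc) x∈s
    processed-or-stacked′ : ∀ {x} → x < suc i → x ∉ indices ((i , a) ∷ s) → x ∈ touchedBy acc
    processed-or-stacked′ {x} x≤i x∉s with x ≟ i
    ... | yes refl = ⊥-elim (x∉s (here refl))
    ... | no x≢i = processed-or-stacked inv (≤∧≢⇒< (s≤s⁻¹ x≤i) x≢i) (x∉s ∘ there)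
    stacked : ∀ {x} → x ∈ indices ((i , a) ∷ s) → x < suc i × OpenAt x
    stacked (here refl) = ≤-refl , a , _ , eq
    stacked (there x∈s) = m≤n⇒m≤1+n (proj₁ (stacked⇒ inv x∈s)) , proj₂ (stacked⇒ inv x∈s)

  match-top : ∀ {acc i j b s a rest} → Invariant acc i ((j , b) ∷ s) → drop i σ ≡ cl a ∷ rest →
    Legal acc (match j i) × Invariant (acc ++ [ match j i ]) (suc i) s
  match-top {acc} {i} {j} {b} {s} {a} {rest} inv eq = (fresh , nested) , record
    { i≤n = i<n
    ; processed⇒ = processed
    ; processed-or-stacked = processed-or-stacked′
    ; stacked⇒ = λ x∈s → m≤n⇒m≤1+n (proj₁ (stacked⇒ inv (there x∈s))) , proj₂ (stacked⇒ inv (there x∈s))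
    ; descending = AllPairs.tail (descending inv)
    }
    where
    i<n : i < n
    i<n = drop-∷⇒< i σ eq
    j<i : j < i
    j<i = proj₁ (stacked⇒ inv (here refl))
    s<j : All (j >_) (indices s)
    s<j = AllPairs.head (descending inv)
    fresh : Fresh acc (match j i)
    fresh (here refl) = (λ j∈acc → proj₂ (processed⇒ inv j∈acc) (here refl)) , <-trans j<i i<n
    fresh (there (here refl)) = (λ i∈acc → <-irrefl refl (proj₁ (processed⇒ inv i∈acc))) , i<n
    unprocessed⇒stacked : ∀ {x} → x < i → x ∉ touchedBy acc → OpenAt x × x ≤ j
    unprocessed⇒stacked {x} x<i x∉acc with x ∈? indices ((j , b) ∷ s)
    ... | no x∉stack = ⊥-elim (x∉acc (processed-or-stacked inv x<i x∉stack))
    ... | yes (here refl) = proj₂ (stacked⇒ inv (here refl)) , ≤-refl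
    ... | yes (there x∈s) = proj₂ (stacked⇒ inv (there x∈s)) , <⇒≤ (All.lookup s<j x∈s)
    nested : Nested acc j i
    nested = record
      { j<i = j<i
      ; open-j = proj₂ (stacked⇒ inv (here refl))
      ; close-i = a , rest , eq
      ; unprocessed⇒stacked = unprocessed⇒stacked
      ; processed⇒< = proj₁ ∘ processed⇒ inv
      }
    processed : ∀ {x} → x ∈ touchedBy (acc ++ [ match j i ]) → x < suc i × x ∉ indices s
    processed x∈ with ∈-touchedBy-∷ʳ⁻ acc (match j i) x∈
    ... | inj₁ x∈acc = m≤n⇒m≤1+n (proj₁ (processed⇒ inv x∈acc)) , proj₂ (processed⇒ inv x∈acc) ∘ there
    ... | inj₂ (here refl) = m≤n⇒m≤1+n j<i , λ j∈s → <-irrefl refl (All.lookup s<j j∈s)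
    ... | inj₂ (there (here refl)) = ≤-refl , λ i∈s → <-irrefl refl (proj₁ (stacked⇒ inv (there i∈s)))
    processed-or-stacked′ : ∀ {x} → x < suc i → x ∉ indices s → x ∈ touchedBy (acc ++ [ match j i ])
    processed-or-stacked′ {x} x≤i x∉s with x ≟ i | x ≟ j
    ... | yes refl | _ = ∈-touchedBy-∷ʳ⁺ʳ acc (match j i) (there (here refl))
    ... | no _ | yes refl = ∈-touchedBy-∷ʳ⁺ʳ acc (match j i) (here refl)
    ... | no x≢i | no x≢j = ∈-touchedBy-∷ʳ⁺ˡ acc (match j i)
      (processed-or-stacked inv (≤∧≢⇒< (s≤s⁻¹ x≤i) x≢i) λ { (here x≡j) → x≢j x≡j ; (there x∈s) → x∉s x∈s })

  LegalStep : List Event → ℕ → List Event × Stack k → Set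
  LegalStep acc i (es , s) = AllLegal acc es × Invariant (acc ++ es) i s

  closeStep-legal : ∀ c t i a s acc {rest} → Invariant acc i s → drop i σ ≡ cl a ∷ rest →
    LegalStep acc (suc i) (closeStep c t i a s)
  closeStep-legal c t i a [] acc inv eq with delete-current inv eq
  ... | legal , inv′ = legal ∷ [] , inv′
  closeStep-legal c t i a ((j , b) ∷ s) acc inv eq with a ≟F b
  ... | yes _ with match-top inv eq
  ...   | legal , inv′ = legal ∷ [] , inv′
  closeStep-legal c t i a ((j , b) ∷ s) acc inv eq | no _ with c t
  ...   | false with delete-current inv eq
  ...     | legal , inv′ = legal ∷ [] , inv′
  closeStep-legal c t i a ((j , b) ∷ s) acc inv eq | no _ | true with delete-top inv
  ...     | legal , inv′ with closeStep-legal c (suc t) i a s (acc ++ [ del j ]) inv′ eq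
  ...       | legal-rest , inv″ =
    legal ∷ legal-rest , subst (λ a → Invariant a (suc i) _) (++-assoc acc [ del j ] _) inv″

  Covering : List Event → Set
  Covering es = ∀ {x} → x < n → x ∈ touchedBy es

  end-legal : ∀ s acc {i} → Invariant acc i s → n ≤ i →
    AllLegal acc (map (del ∘ proj₁) s) × Covering (acc ++ map (del ∘ proj₁) s)
  end-legal [] acc inv n≤i =
    [] , λ x<n → subst (λ a → _ ∈ touchedBy a) (sym (++-identityʳ acc))
                       (processed-or-stacked inv (≤-trans x<n n≤i) λ ())
  end-legal ((j , b) ∷ s) acc inv n≤i with delete-top inv
  ... | legal , inv′ with end-legal s (acc ++ [ del j ]) inv′ n≤i
  ...   | legal-rest , covering =
    legal ∷ legal-rest , subst (λ a → _ ∈ touchedBy a) (++-assoc acc [ del j ] _) ∘ covering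

  run-legal : ∀ c t i σ′ s acc → Invariant acc i s → drop i σ ≡ σ′ →
    AllLegal acc (run c t i σ′ s) × Covering (acc ++ run c t i σ′ s)
  run-legal c t i [] s acc inv eq = end-legal s acc inv (drop-[]⇒≤ i σ eq)
  run-legal c t i (op a ∷ σ′) s acc inv eq =
    run-legal c t (suc i) σ′ ((i , a) ∷ s) acc (push inv eq) (drop-suc i σ eq)
  run-legal c t i (cl a ∷ σ′) s acc inv eq with closeStep c t i a s | closeStep-legal c t i a s acc inv eq
  ... | es , s′ | legal , inv′ with run-legal c (t + length es) (suc i) σ′ s′ (acc ++ es) inv′ (drop-suc i σ eq)
  ...   | legal-rest , covering =
    AllLegal-++ es legal legal-rest , subst (λ a → _ ∈ touchedBy a) (++-assoc acc es _) ∘ covering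

  initial : Invariant [] 0 []
  initial = record
    { i≤n = z≤n ; processed⇒ = λ () ; processed-or-stacked = λ () ; stacked⇒ = λ () ; descending = [] }

  trace-legal : ∀ c → AllLegal [] (trace c σ)
  trace-legal c = proj₁ (run-legal c 0 0 σ [] [] initial refl)

  trace-covering : ∀ c → Covering (trace c σ)
  trace-covering c = proj₂ (run-legal c 0 0 σ [] [] initial refl)

  module _ (c : ℕ → Bool) where

    private
      es : List Event
      es = trace c σ

    matched⇒Nested : ∀ {j i} → match j i ∈ es → ∃[ pre ] (Nested pre j i × (∀ {e} → e ∈ pre → e ∈ es))
    matched⇒Nested m with AllLegal-∈ (trace-legal c) m
    ... | pre , (_ , nested) , pre⊆es = pre , nested , pre⊆es

    matched⇒< : ∀ {j i} → match j i ∈ es → j < i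
    matched⇒< m = Nested.j<i (proj₁ (proj₂ (matched⇒Nested m)))

    matched⇒OpenAt : ∀ {j i} → match j i ∈ es → OpenAt j
    matched⇒OpenAt m = Nested.open-j (proj₁ (proj₂ (matched⇒Nested m)))

    matched⇒CloseAt : ∀ {j i} → match j i ∈ es → CloseAt i
    matched⇒CloseAt m = Nested.close-i (proj₁ (proj₂ (matched⇒Nested m)))

    trace-disjoint : ∀ {e₁ e₂ x} → e₁ ∈ es → e₂ ∈ es → x ∈ touched e₁ → x ∈ touched e₂ → e₁ ≡ e₂
    trace-disjoint = AllLegal-disjoint (trace-legal c)

    touched⇒< : ∀ {e x} → e ∈ es → x ∈ touched e → x < n
    touched⇒< {e} m x∈e with AllLegal-∈ (trace-legal c) m
    ... | _ , legal , _ = proj₂ (Legal⇒Fresh e legal x∈e)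

    partner-of-close : ∀ {i q} → CloseAt i → Partner es i q → match q i ∈ es
    partner-of-close {i} close-i (inj₁ m) = ⊥-elim (OpenAt⇒¬CloseAt {i} (matched⇒OpenAt m) close-i)
    partner-of-close close-i (inj₂ m) = m

    partner-of-open : ∀ {j p} → OpenAt j → Partner es j p → match j p ∈ es
    partner-of-open open-j (inj₁ m) = m
    partner-of-open {j} open-j (inj₂ m) = ⊥-elim (OpenAt⇒¬CloseAt {j} open-j (matched⇒CloseAt m))

    trace-partition : Partition n es
    trace-partition = record
      { partner-unique = partner-unique
      ; partner-irreflexive = λ x~x → <-irrefl refl (matched⇒< ([ id , id ]′ x~x))
      ; partner-< = λ { (inj₁ m) → touched⇒< m (there (here refl)) ; (inj₂ m) → touched⇒< m (here refl) }
      ; partnered⇒undeleted = partnered⇒undeleted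
      ; deleted-or-partnered = deleted-or-partnered
      }
      where
      partner-unique : ∀ {x y z} → Partner es x y → Partner es x z → y ≡ z
      partner-unique (inj₁ m₁) (inj₁ m₂) with trace-disjoint m₁ m₂ (here refl) (here refl)
      ... | refl = refl
      partner-unique (inj₁ m₁) (inj₂ m₂) with trace-disjoint m₁ m₂ (here refl) (there (here refl))
      ... | refl = refl
      partner-unique (inj₂ m₁) (inj₁ m₂) with trace-disjoint m₁ m₂ (there (here refl)) (here refl)
      ... | refl = refl
      partner-unique (inj₂ m₁) (inj₂ m₂) with trace-disjoint m₁ m₂ (there (here refl)) (there (here refl))
      ... | refl = refl
      partnered⇒undeleted : ∀ {x y} → Partner es x y → x ∉ deletedIdx es
      partnered⇒undeleted (inj₁ m) x∈del
        with trace-disjoint m (deletedIdx⇒del∈ es x∈del) (here refl) (here refl)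
      ... | ()
      partnered⇒undeleted (inj₂ m) x∈del
        with trace-disjoint m (deletedIdx⇒del∈ es x∈del) (there (here refl)) (here refl)
      ... | ()
      deleted-or-partnered : ∀ {x} → x < n → x ∈ deletedIdx es ⊎ ∃ (Partner es x)
      deleted-or-partnered x<n with ∈-touchedBy⁻ (trace-covering c x<n)
      ... | del _ , m , here refl = inj₁ (del∈⇒deletedIdx m)
      ... | match _ b , m , here refl = inj₂ (b , inj₁ m)
      ... | match a _ , m , there (here refl) = inj₂ (a , inj₂ m)

    trace-noncrossing : ∀ {q i j p} → match q i ∈ es → match j p ∈ es → q < j → j < i → i < p → ⊥
    trace-noncrossing {q} {i} {j} {p} qi∈es jp∈es q<j j<i i<p with matched⇒Nested qi∈es
    ... | pre , nested , pre⊆es with j ∈? touchedBy pre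
    ...   | no j∉pre = <⇒≱ q<j (proj₂ (Nested.unprocessed⇒stacked nested j<i j∉pre))
    ...   | yes j∈pre with ∈-touchedBy⁻ j∈pre
    ...     | e , e∈pre , j∈e with trace-disjoint (pre⊆es e∈pre) jp∈es j∈e (here refl)
    ...       | refl = <⇒≱ i<p (<⇒≤ (Nested.processed⇒< nested (∈-touchedBy⁺ e∈pre (there (here refl)))))

  trace-admissible : ∀ copt c t {e post} → drop t (trace c σ) ≡ e ∷ post →
    Admissible n (trace copt σ) (A (trace c σ) t) e
  trace-admissible copt c t {del x} eq = AllLegal-drop (trace-legal c) t eq (here refl)
  trace-admissible copt c t {match j i} eq with AllLegal-drop (trace-legal c) t eq
  ... | fresh , nested =
    proj₁ (fresh (here refl)) , proj₁ (fresh (there (here refl))) ,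
    proj₂ (fresh (here refl)) , proj₂ (fresh (there (here refl))) , <⇒≢ (Nested.j<i nested) , untangled
    where
    L : List ℕ
    L = A (trace c σ) t
    -- were both optimal partners unprocessed, q < j < i < p would be two crossing optimal matches
    untangled : Untangled (trace copt σ) L j i
    untangled ¬j~i {p} {q} j~p i~q with p ∈? L | q ∈? L
    ... | yes p∈L | _ = inj₁ p∈L
    ... | no _ | yes q∈L = inj₂ q∈L
    ... | no p∉L | no q∉L = ⊥-elim (trace-noncrossing copt qi∈opt jp∈opt q<j (Nested.j<i nested) i<p)
      where
      qi∈opt : match q i ∈ trace copt σ
      qi∈opt = partner-of-close copt (Nested.close-i nested) i~q
      jp∈opt : match j p ∈ trace copt σ
      jp∈opt = partner-of-open copt (Nested.open-j nested) j~p
      q<j : q < j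
      q<j with q ≟ j
      ... | yes refl = ⊥-elim (¬j~i (inj₁ qi∈opt))
      ... | no q≢j = ≤∧≢⇒< (proj₂ (Nested.unprocessed⇒stacked nested (matched⇒< copt qi∈opt) q∉L)) q≢j
      i<p : i < p
      i<p with <-cmp p i
      ... | tri< p<i _ _ = ⊥-elim (OpenAt⇒¬CloseAt {p} (proj₁ (Nested.unprocessed⇒stacked nested p<i p∉L))
                                    (matched⇒CloseAt copt jp∈opt))
      ... | tri≈ _ refl _ = ⊥-elim (¬j~i (inj₁ jp∈opt))
      ... | tri> _ _ i<p = i<p

lemma6 : (k : ℕ) (σ : List (Sym k)) (copt c : ℕ → Bool) →
    OptimalChoice copt σ →
    editDist (finalString c σ) σ
      ≤ numDel (trace copt σ) + 2 * wrongMoves (length σ) (trace copt σ) (trace c σ)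
lemma6 k σ copt c _ = begin
  editDist (finalString c σ) σ  ≤⟨ editDist-finalString c σ ⟩
  numDel (trace c σ)            ≤⟨ deletions-bound (trace c σ) (trace-admissible copt c) ⟩
  numDel (trace copt σ) + 2 * wrongMoves (length σ) (trace copt σ) (trace c σ) ∎
  where
  open ≤-Reasoning
  open Traces σ
  open Potential (trace-partition copt)
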